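{- Let $\mathcal{I}$ be a finite implication algebra with set of minimal elements $M_I$ and implication profile $p=p_I$. Then (a) $p$ is decreasing; (b) $p$ is submodular; (c) for any nonempty $A\subseteq M_I$, the functions $p_A,q_A\colon\mathcal{P}(M_I\setminus A)\setminus\{\emptyset\}\to\mathbb{N}$ defined by $p_A(X)=p(X\cup A)$ and $q_A(X)=p(X)-p(X\cup A)$ are both decreasing and submodular.
   Context: An implication algebra is a set with a binary operation $\to$ satisfying $(x\to y)\to x=x$, $(x\to y)\to y=(y\to x)\to x$, $x\to(y\to z)=y\to(x\to z)$; ordered by $x\le y$ iff $x\to y=\mathbf{1}$ it is a join-semilattice with top $\mathbf{1}$ whose principal filters are Boolean algebras. $M_I$ is the set of minimal elements, and the implication profile $p_I\colon\mathcal{P}(M_I)\setminus\{\emptyset\}\to\mathbb{N}$ is defined by $p_I(S)=k$ iff $[\bigvee S,\mathbf{1}]\cong 2^k$. For a function $f$ defined on the nonempty subsets of a finite set $N$: $f$ is decreasing if $S_1\subseteq S_2$ implies $f(S_1)\ge f(S_2)$; $f$ is submodular (in this paper's sense) if for all $S_1,S_2\subseteq N$ with $S_1\cap S_2\neq\emptyset$ we have $f(S_1)+f(S_2)\le f(S_1\cup S_2)+f(S_1\cap S_2)$. -}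

module Defs where

open import Data.Nat using (ℕ; _+_; _∸_; _≤_)
open import Data.Fin using (Fin)
open import Data.Fin.Subset using (Subset; _∈_; _∉_; _⊆_; _∩_; _∪_; Nonempty)
open import Data.Product using (Σ; _×_)
open import Relation.Binary.PropositionalEquality using (_≡_)
open import Function.Bundles using (_⇔_)

-- A finite implication algebra, with carrier Fin n (every finite algebra is
-- isomorphic to one of this form).
record ImplicationAlgebra (n : ℕ) : Set where
  field
    _⇒_   : Fin n → Fin n → Fin n
    law₁  : ∀ x y → (x ⇒ y) ⇒ x ≡ x
    law₂  : ∀ x y → (x ⇒ y) ⇒ y ≡ (y ⇒ x) ⇒ x
    law₃  : ∀ x y z → x ⇒ (y ⇒ z) ≡ y ⇒ (x ⇒ z)

  -- the top element 𝟏 is y ⇒ y (for any y); x ≤ y iff x ⇒ y = 𝟏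
  _≤ᵢ_ : Fin n → Fin n → Set
  x ≤ᵢ y = x ⇒ y ≡ y ⇒ y

  IsMinimal : Fin n → Set
  IsMinimal m = ∀ x → x ≤ᵢ m → x ≡ m

  SubsetOfM : Subset n → Set
  SubsetOfM S = ∀ x → x ∈ S → IsMinimal x

  SubsetOfM∖ : Subset n → Subset n → Set
  SubsetOfM∖ A S = ∀ x → x ∈ S → IsMinimal x × x ∉ A

  IsJoin : Subset n → Fin n → Set
  IsJoin S j = (∀ x → x ∈ S → x ≤ᵢ j) × (∀ u → (∀ x → x ∈ S → x ≤ᵢ u) → j ≤ᵢ u)

  -- the interval [j, 𝟏] is order-isomorphic to the Boolean lattice 2^k
  -- (subsets of Fin k ordered by inclusion)
  record IntervalIso (j : Fin n) (k : ℕ) : Set where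
    field
      to      : (x : Fin n) → j ≤ᵢ x → Subset k
      from    : Subset k → Fin n
      from-in : ∀ s → j ≤ᵢ from s
      from∘to : ∀ x (p : j ≤ᵢ x) → from (to x p) ≡ x
      to∘from : ∀ s → to (from s) (from-in s) ≡ s
      order   : ∀ x y (p : j ≤ᵢ x) (q : j ≤ᵢ y) → (x ≤ᵢ y) ⇔ (to x p ⊆ to y q)

  IsProfile : (Subset n → ℕ) → Set
  IsProfile p = ∀ S → SubsetOfM S → Nonempty S → ∀ j → IsJoin S j → IntervalIso j (p S)

Decreasing : {n : ℕ} → (Subset n → Set) → (Subset n → ℕ) → Set
Decreasing D f = ∀ S₁ S₂ → D S₁ → D S₂ → Nonempty S₁ → S₁ ⊆ S₂ → f S₂ ≤ f S₁

Submodular : {n : ℕ} → (Subset n → Set) → (Subset n → ℕ) → Set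
Submodular D f = ∀ S₁ S₂ → D S₁ → D S₂ → Nonempty (S₁ ∩ S₂) →
  f S₁ + f S₂ ≤ f (S₁ ∪ S₂) + f (S₁ ∩ S₂)

module Submission where

-- Fix a nonempty B ⊆ M_I with join b.  The interval [b, 𝟏] is a
-- Boolean lattice 2^K with K = p(B), so every S ⊇ B gets a coordinate
-- c(S) ⊆ Fin K, the image of ⋁S.  Two facts turn p into cardinalities:
--   * the dimension lemma: if [j, 𝟏] ≅ 2^K, j ≤ x and [x, 𝟏] ≅ 2^k, then the
--     image of x in 2^K has K - k points; hence p(S) = K - |c(S)|;
--   * joins become unions: c(S ∪ T) = c(S) ∪ c(T), and c is monotone.
-- Consequently q_A(X) = |c(A) ∖ c(X)|, and every claim becomes an instance of
-- the modular law |P ∪ Q| + |P ∩ Q| = |P| + |Q| for subsets of Fin K, taking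
-- B to be the smallest set occurring in the inequality.

open import Defs
open import Data.Nat using (ℕ; zero; suc; _+_; _∸_; _≤_; _<_; s≤s; s≤s⁻¹)
open import Data.Nat.Properties using (+-suc; +-comm; +-assoc; +-identityʳ; +-mono-≤; +-monoˡ-≤; +-monoʳ-≤;
  +-cancelʳ-≤; +-cancelʳ-≡; ≤-reflexive; ≤-trans; ≤-antisym; m≤n+m; m≤n+m∸n; m+n≤o⇒m≤o;
  m+n≤o⇒n≤o; m+n∸m≡n; m∸n+n≡m; +-commutativeSemigroup; module ≤-Reasoning)
open import Data.Fin using (Fin; zero; suc)
open import Data.Fin.Subset
open import Data.Fin.Subset.Properties
open import Data.Fin.Properties using (any?)
open import Data.Vec using ([]; _∷_)
open import Data.List using (List; []; _∷_; foldr; filter; allFin)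
open import Data.List.Membership.Propositional using () renaming (_∈_ to _∈ₗ_)
open import Data.List.Membership.Propositional.Properties using (∈-allFin; ∈-filter⁺; ∈-filter⁻)
open import Data.List.Relation.Unary.Any using (here; there)
open import Data.Product using (∃; _×_; _,_; proj₁; proj₂)
open import Data.Empty using (⊥-elim)
open import Data.Sum using ([_,_]′)
open import Function using (_∘_)
open import Function.Bundles using (Equivalence)
open import Relation.Nullary using (¬_; yes; no; ¬?)
open import Relation.Nullary.Decidable using (_×-dec_; decidable-stable)
open import Relation.Binary.PropositionalEquality
open import Algebra.Properties.CommutativeSemigroup +-commutativeSemigroup using (interchange)
import Algebra.Properties.IdempotentCommutativeMonoid as ICM

-- Cardinalities of finite subsets

card-modular : ∀ {K} (P Q : Subset K) → ∣ P ∪ Q ∣ + ∣ P ∩ Q ∣ ≡ ∣ P ∣ + ∣ Q ∣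
card-modular []            []            = refl
card-modular (inside  ∷ P) (inside  ∷ Q) =
  cong suc (trans (+-suc _ _) (trans (cong suc (card-modular P Q)) (sym (+-suc _ _))))
card-modular (inside  ∷ P) (outside ∷ Q) = cong suc (card-modular P Q)
card-modular (outside ∷ P) (inside  ∷ Q) = trans (cong suc (card-modular P Q)) (sym (+-suc _ _))
card-modular (outside ∷ P) (outside ∷ Q) = card-modular P Q

card-∪-split : ∀ {K} (P U : Subset K) → ∣ P ∪ U ∣ ≡ ∣ P ∣ + ∣ U ∩ ∁ P ∣
card-∪-split []            []            = refl
card-∪-split (inside  ∷ P) (inside  ∷ U) = cong suc (card-∪-split P U)
card-∪-split (inside  ∷ P) (outside ∷ U) = cong suc (card-∪-split P U)
card-∪-split (outside ∷ P) (inside  ∷ U) = trans (cong suc (card-∪-split P U)) (sym (+-suc _ _))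
card-∪-split (outside ∷ P) (outside ∷ U) = card-∪-split P U

card-∪≤ : ∀ {K} (P Q : Subset K) → ∣ P ∪ Q ∣ ≤ ∣ P ∣ + ∣ Q ∣
card-∪≤ P Q = m+n≤o⇒m≤o ∣ P ∪ Q ∣ (≤-reflexive (card-modular P Q))

missing-point : ∀ {K} (d : Subset K) → ∣ d ∣ < K → ∃ λ x → x ∉ d
missing-point (outside ∷ d) _ = zero , λ ()
missing-point (inside ∷ d) |d|<K with missing-point d (s≤s⁻¹ |d|<K)
... | x , x∉d = suc x , x∉d ∘ drop-there

-- an inclusion that cannot be reversed is strict (finiteness makes the
-- missing point computable)
⊆∧⊉⇒⊂ : ∀ {K} {P Q : Subset K} → P ⊆ Q → ¬ (Q ⊆ P) → P ⊂ Q
⊆∧⊉⇒⊂ {P = P} {Q} P⊆Q Q⊈P with any? (λ x → x ∈? Q ×-dec ¬? (x ∈? P))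
... | yes (x , x∈Q , x∉P) = P⊆Q , x , x∈Q , x∉P
... | no none = ⊥-elim (Q⊈P Q⊆P)
  where
  Q⊆P : Q ⊆ P
  Q⊆P {x} x∈Q = decidable-stable (x ∈? P) (λ x∉P → none (x , x∈Q , x∉P))

outside-antitone : ∀ {K} {P Q : Subset K} (U : Subset K) → P ⊆ Q → U ∩ ∁ Q ⊆ U ∩ ∁ P
outside-antitone {P = P} {Q} U P⊆Q x∈ with x∈p∩q⁻ U (∁ Q) x∈
... | x∈U , x∈∁Q = x∈p∩q⁺ (x∈U , x∉p⇒x∈∁p (x∈∁p⇒x∉p x∈∁Q ∘ P⊆Q))

outside-submodular : ∀ {K} {P Q R : Subset K} (U : Subset K) → R ⊆ P → R ⊆ Q →
  ∣ U ∩ ∁ P ∣ + ∣ U ∩ ∁ Q ∣ ≤ ∣ U ∩ ∁ (P ∪ Q) ∣ + ∣ U ∩ ∁ R ∣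
outside-submodular {P = P} {Q} {R} U R⊆P R⊆Q = begin
  ∣ U ∩ ∁ P ∣ + ∣ U ∩ ∁ Q ∣                              ≡⟨ card-modular (U ∩ ∁ P) (U ∩ ∁ Q) ⟨
  ∣ (U ∩ ∁ P) ∪ (U ∩ ∁ Q) ∣ + ∣ (U ∩ ∁ P) ∩ (U ∩ ∁ Q) ∣  ≤⟨ +-mono-≤ (p⊆q⇒∣p∣≤∣q∣ ∪⊆) (p⊆q⇒∣p∣≤∣q∣ ∩⊆) ⟩
  ∣ U ∩ ∁ R ∣ + ∣ U ∩ ∁ (P ∪ Q) ∣                        ≡⟨ +-comm ∣ U ∩ ∁ R ∣ _ ⟩
  ∣ U ∩ ∁ (P ∪ Q) ∣ + ∣ U ∩ ∁ R ∣                        ∎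
  where
  open ≤-Reasoning
  ∪⊆ : (U ∩ ∁ P) ∪ (U ∩ ∁ Q) ⊆ U ∩ ∁ R
  ∪⊆ x∈ = [ outside-antitone U R⊆P , outside-antitone U R⊆Q ]′ (x∈p∪q⁻ _ _ x∈)
  ∩⊆ : (U ∩ ∁ P) ∩ (U ∩ ∁ Q) ⊆ U ∩ ∁ (P ∪ Q)
  ∩⊆ x∈ with x∈p∩q⁻ (U ∩ ∁ P) _ x∈
  ... | x∈U∖P , x∈U∖Q with x∈p∩q⁻ U (∁ P) x∈U∖P | x∈p∩q⁻ U (∁ Q) x∈U∖Q
  ...   | x∈U , x∈∁P | _ , x∈∁Q = x∈p∩q⁺ (x∈U , x∉p⇒x∈∁p
          (λ x∈P∪Q → [ x∈∁p⇒x∉p x∈∁P , x∈∁p⇒x∉p x∈∁Q ]′ (x∈p∪q⁻ P Q x∈P∪Q)))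

∪-monoʳ : ∀ {K} (P : Subset K) {Q R : Subset K} → Q ⊆ R → P ∪ Q ⊆ P ∪ R
∪-monoʳ P {Q} {R} Q⊆R x∈ = [ p⊆p∪q R , q⊆p∪q P R ∘ Q⊆R ]′ (x∈p∪q⁻ P Q x∈)

∪-monoˡ : ∀ {K} {P Q : Subset K} (R : Subset K) → P ⊆ Q → P ∪ R ⊆ Q ∪ R
∪-monoˡ {P = P} {Q} R P⊆Q x∈ = [ p⊆p∪q R ∘ P⊆Q , q⊆p∪q Q R ]′ (x∈p∪q⁻ P R x∈)

∪-least : ∀ {K} {P Q R : Subset K} → P ⊆ R → Q ⊆ R → P ∪ Q ⊆ R
∪-least {P = P} {Q} P⊆R Q⊆R x∈ = [ P⊆R , Q⊆R ]′ (x∈p∪q⁻ P Q x∈)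

-- Arithmetic of complements: numbers of the form c - x, written a + x ≡ c

antitone-complement : ∀ a b {c x y} → a + x ≡ c → b + y ≡ c → x ≤ y → b ≤ a
antitone-complement a b {x = x} {y} a+x≡c b+y≡c x≤y = +-cancelʳ-≤ y b a (begin
  b + y ≡⟨ trans b+y≡c (sym a+x≡c) ⟩
  a + x ≤⟨ +-monoʳ-≤ a x≤y ⟩
  a + y ∎)
  where open ≤-Reasoning

submodular-complement : ∀ a₁ a₂ a₃ a₄ {c x₁ x₂ x₃ x₄} →
  a₁ + x₁ ≡ c → a₂ + x₂ ≡ c → a₃ + x₃ ≡ c → a₄ + x₄ ≡ c →
  x₃ + x₄ ≤ x₁ + x₂ → a₁ + a₂ ≤ a₃ + a₄
submodular-complement a₁ a₂ a₃ a₄ {x₁ = x₁} {x₂} {x₃} {x₄} e₁ e₂ e₃ e₄ x-ineq =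
  +-cancelʳ-≤ (x₃ + x₄) (a₁ + a₂) (a₃ + a₄) (begin
    (a₁ + a₂) + (x₃ + x₄) ≤⟨ +-monoʳ-≤ (a₁ + a₂) x-ineq ⟩
    (a₁ + a₂) + (x₁ + x₂) ≡⟨ interchange a₁ a₂ x₁ x₂ ⟩
    (a₁ + x₁) + (a₂ + x₂) ≡⟨ cong₂ _+_ (trans e₁ (sym e₃)) (trans e₂ (sym e₄)) ⟩
    (a₃ + x₃) + (a₄ + x₄) ≡⟨ interchange a₃ x₃ a₄ x₄ ⟩
    (a₃ + a₄) + (x₃ + x₄) ∎)
  where open ≤-Reasoning

complement-difference : ∀ a b {c x t} → a + x ≡ c → b + (x + t) ≡ c → a ∸ b ≡ t
complement-difference a b {x = x} {t} a+x≡c b+x+t≡c = begin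
  a ∸ b       ≡⟨ cong (_∸ b) (+-cancelʳ-≡ x a (b + t) a+x≡b+t+x) ⟩
  b + t ∸ b   ≡⟨ m+n∸m≡n b t ⟩
  t           ∎
  where
  open ≡-Reasoning
  a+x≡b+t+x : a + x ≡ (b + t) + x
  a+x≡b+t+x = begin
    a + x       ≡⟨ trans a+x≡c (sym b+x+t≡c) ⟩
    b + (x + t) ≡⟨ cong (b +_) (+-comm x t) ⟩
    b + (t + x) ≡⟨ +-assoc b t x ⟨
    (b + t) + x ∎

-- H is monotone and reflects
-- inclusion into sets above s, so it embeds the upper set of s in 2^K
-- into 2^M; the gap lemma says |H ⊤| - |H d| ≥ K - |d| for d ⊇ s.
module OrderEmbedding {K M : ℕ} (s : Subset K) (H : Subset K → Subset M)
  (mono    : ∀ {d d'} → d ⊆ d' → H d ⊆ H d')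
  (reflect : ∀ {d d'} → s ⊆ d' → H d ⊆ H d' → d ⊆ d') where

  grow : ∀ {d x} → s ⊆ d → x ∉ d → ∣ H d ∣ < ∣ H (d ∪ ⁅ x ⁆) ∣
  grow {d} {x} s⊆d x∉d = p⊂q⇒∣p∣<∣q∣ (⊆∧⊉⇒⊂ (mono (p⊆p∪q ⁅ x ⁆)) cannot-shrink)
    where
    cannot-shrink : ¬ (H (d ∪ ⁅ x ⁆) ⊆ H d)
    cannot-shrink back = x∉d (reflect s⊆d back (q⊆p∪q d ⁅ x ⁆ (x∈⁅x⁆ x)))

  -- climb from d to ⊤ one point at a time
  gap : ∀ m {d} → s ⊆ d → m + ∣ d ∣ ≤ K → ∣ H d ∣ + m ≤ ∣ H ⊤ ∣
  gap zero {d} _ _ = begin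
    ∣ H d ∣ + 0 ≡⟨ +-identityʳ _ ⟩
    ∣ H d ∣     ≤⟨ p⊆q⇒∣p∣≤∣q∣ (mono ⊆⊤) ⟩
    ∣ H ⊤ ∣     ∎
    where open ≤-Reasoning
  gap (suc m) {d} s⊆d bound with missing-point d (≤-trans (s≤s (m≤n+m ∣ d ∣ m)) bound)
  ... | x , x∉d = begin
    ∣ H d ∣ + suc m         ≡⟨ +-suc _ m ⟩
    suc ∣ H d ∣ + m         ≤⟨ +-monoˡ-≤ m (grow s⊆d x∉d) ⟩
    ∣ H (d ∪ ⁅ x ⁆) ∣ + m   ≤⟨ gap m (⊆-trans s⊆d (p⊆p∪q ⁅ x ⁆)) bound′ ⟩
    ∣ H ⊤ ∣                 ∎
    where
    open ≤-Reasoning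
    one-more : ∣ d ∪ ⁅ x ⁆ ∣ ≤ suc ∣ d ∣
    one-more = ≤-trans (card-∪≤ d ⁅ x ⁆)
      (≤-reflexive (trans (cong (∣ d ∣ +_) (∣⁅x⁆∣≡1 x)) (+-comm ∣ d ∣ 1)))
    bound′ : m + ∣ d ∪ ⁅ x ⁆ ∣ ≤ K
    bound′ = ≤-trans (+-monoʳ-≤ m one-more) (≤-trans (≤-reflexive (+-suc m ∣ d ∣)) bound)

module Joins {n : ℕ} (I : ImplicationAlgebra n) where
  open ImplicationAlgebra I

  ⇒-absorb : ∀ x y → x ⇒ (x ⇒ y) ≡ x ⇒ y
  ⇒-absorb x y = begin
    x ⇒ (x ⇒ y)             ≡⟨ cong (_⇒ (x ⇒ y)) (law₁ x y) ⟨
    ((x ⇒ y) ⇒ x) ⇒ (x ⇒ y) ≡⟨ law₁ (x ⇒ y) x ⟩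
    x ⇒ y                   ∎
    where open ≡-Reasoning

  self-⇒ : ∀ x y → x ⇒ x ≡ (x ⇒ y) ⇒ (x ⇒ y)
  self-⇒ x y = begin
    x ⇒ x                   ≡⟨ cong (_⇒ x) (law₁ x y) ⟨
    ((x ⇒ y) ⇒ x) ⇒ x       ≡⟨ law₂ (x ⇒ y) x ⟩
    (x ⇒ (x ⇒ y)) ⇒ (x ⇒ y) ≡⟨ cong (_⇒ (x ⇒ y)) (⇒-absorb x y) ⟩
    (x ⇒ y) ⇒ (x ⇒ y)       ∎
    where open ≡-Reasoning

  top-unique : ∀ x y → x ⇒ x ≡ y ⇒ y
  top-unique x y = begin
    x ⇒ x                                 ≡⟨ self-⇒ x y ⟩
    (x ⇒ y) ⇒ (x ⇒ y)                     ≡⟨ self-⇒ (x ⇒ y) y ⟩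
    ((x ⇒ y) ⇒ y) ⇒ ((x ⇒ y) ⇒ y)         ≡⟨ cong (λ t → t ⇒ t) (law₂ x y) ⟩
    ((y ⇒ x) ⇒ x) ⇒ ((y ⇒ x) ⇒ x)         ≡⟨ self-⇒ (y ⇒ x) x ⟨
    (y ⇒ x) ⇒ (y ⇒ x)                     ≡⟨ self-⇒ y x ⟨
    y ⇒ y                                 ∎
    where open ≡-Reasoning

  ≤ᵢ-intro : ∀ {x y} z → x ⇒ y ≡ z ⇒ z → x ≤ᵢ y
  ≤ᵢ-intro {y = y} z e = trans e (top-unique z y)

  ⇒-top : ∀ x y → x ⇒ (y ⇒ y) ≡ y ⇒ y
  ⇒-top x y = begin
    x ⇒ (y ⇒ y) ≡⟨ cong (x ⇒_) (top-unique y x) ⟩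
    x ⇒ (x ⇒ x) ≡⟨ ⇒-absorb x x ⟩
    x ⇒ x       ≡⟨ top-unique x y ⟩
    y ⇒ y       ∎
    where open ≡-Reasoning

  ≤ᵢ-trans : ∀ {x y z} → x ≤ᵢ y → y ≤ᵢ z → x ≤ᵢ z
  ≤ᵢ-trans {x} {y} {z} x≤y y≤z = ≤ᵢ-intro y (begin
    x ⇒ z                   ≡⟨ cong (x ⇒_) (trans (cong (_⇒ z) y≤z) (law₁ z z)) ⟨
    x ⇒ ((y ⇒ z) ⇒ z)       ≡⟨ cong (x ⇒_) (law₂ y z) ⟩
    x ⇒ ((z ⇒ y) ⇒ y)       ≡⟨ law₃ x (z ⇒ y) y ⟩
    (z ⇒ y) ⇒ (x ⇒ y)       ≡⟨ cong ((z ⇒ y) ⇒_) x≤y ⟩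
    (z ⇒ y) ⇒ (y ⇒ y)       ≡⟨ ⇒-top (z ⇒ y) y ⟩
    y ⇒ y                   ∎)
    where open ≡-Reasoning

  infixl 30 _⊔_
  _⊔_ : Fin n → Fin n → Fin n
  x ⊔ y = (x ⇒ y) ⇒ y

  ⊔-upperˡ : ∀ x y → x ≤ᵢ x ⊔ y
  ⊔-upperˡ x y = ≤ᵢ-intro (x ⇒ y) (law₃ x (x ⇒ y) y)

  ⊔-upperʳ : ∀ x y → y ≤ᵢ x ⊔ y
  ⊔-upperʳ x y = ≤ᵢ-intro y (trans (law₃ y (x ⇒ y) y) (⇒-top (x ⇒ y) y))

  ⇒-antitone : ∀ {a b} c → a ≤ᵢ b → (b ⇒ c) ≤ᵢ (a ⇒ c)
  ⇒-antitone {a} {b} c a≤b =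
    ≤ᵢ-intro (b ⊔ c) (trans (law₃ (b ⇒ c) a c) (≤ᵢ-trans a≤b (⊔-upperˡ b c)))

  ⊔-of-≤ : ∀ {y z} → y ≤ᵢ z → z ⊔ y ≡ z
  ⊔-of-≤ {y} {z} y≤z = trans (law₂ z y) (trans (cong (_⇒ z) y≤z) (law₁ z z))

  ⊔-least : ∀ {x y z} → x ≤ᵢ z → y ≤ᵢ z → x ⊔ y ≤ᵢ z
  ⊔-least {x} {y} {z} x≤z y≤z =
    subst (x ⊔ y ≤ᵢ_) (⊔-of-≤ y≤z) (⇒-antitone y (⇒-antitone y x≤z))

  IsLub : Fin n → Fin n → Fin n → Set
  IsLub a c e = a ≤ᵢ e × c ≤ᵢ e × (∀ u → a ≤ᵢ u → c ≤ᵢ u → e ≤ᵢ u)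

  foldr-base : ∀ b l → b ≤ᵢ foldr _⊔_ b l
  foldr-base b []      = refl
  foldr-base b (y ∷ l) = ≤ᵢ-trans (foldr-base b l) (⊔-upperʳ y _)

  foldr-upper : ∀ {x} b l → x ∈ₗ l → x ≤ᵢ foldr _⊔_ b l
  foldr-upper b (y ∷ l) (here refl) = ⊔-upperˡ y _
  foldr-upper b (y ∷ l) (there x∈l) = ≤ᵢ-trans (foldr-upper b l x∈l) (⊔-upperʳ y _)

  foldr-least : ∀ {u} b l → b ≤ᵢ u → (∀ {x} → x ∈ₗ l → x ≤ᵢ u) → foldr _⊔_ b l ≤ᵢ u
  foldr-least b []      b≤u _  = b≤u
  foldr-least b (y ∷ l) b≤u ub = ⊔-least (ub (here refl)) (foldr-least b l b≤u (ub ∘ there))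

  members : Subset n → List (Fin n)
  members S = filter (_∈? S) (allFin n)

  infix 30 ⋁[_]_
  ⋁[_]_ : Fin n → Subset n → Fin n
  ⋁[ b ] S = foldr _⊔_ b (members S)

  ⋁-base : ∀ b S → b ≤ᵢ ⋁[ b ] S
  ⋁-base b S = foldr-base b (members S)

  ⋁-upper : ∀ b {S x} → x ∈ S → x ≤ᵢ ⋁[ b ] S
  ⋁-upper b {S} {x} x∈S = foldr-upper b (members S) (∈-filter⁺ (_∈? S) (∈-allFin x) x∈S)

  ⋁-least : ∀ b S {u} → b ≤ᵢ u → (∀ x → x ∈ S → x ≤ᵢ u) → ⋁[ b ] S ≤ᵢ u
  ⋁-least b S b≤u ub =
    foldr-least b (members S) b≤u (λ m → ub _ (proj₂ (∈-filter⁻ (_∈? S) {xs = allFin n} m)))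

  ⋁-mono : ∀ b {S T} → S ⊆ T → ⋁[ b ] S ≤ᵢ ⋁[ b ] T
  ⋁-mono b {S} {T} S⊆T = ⋁-least b S (⋁-base b T) (λ x x∈S → ⋁-upper b (S⊆T x∈S))

  ⋁-∪ : ∀ b S T → IsLub (⋁[ b ] S) (⋁[ b ] T) (⋁[ b ] (S ∪ T))
  ⋁-∪ b S T = ⋁-mono b (p⊆p∪q T) , ⋁-mono b (q⊆p∪q S T) , least
    where
    least : ∀ u → ⋁[ b ] S ≤ᵢ u → ⋁[ b ] T ≤ᵢ u → ⋁[ b ] (S ∪ T) ≤ᵢ u
    least u S≤u T≤u = ⋁-least b (S ∪ T) (≤ᵢ-trans (⋁-base b S) S≤u) λ x x∈ →
      [ (λ x∈S → ≤ᵢ-trans (⋁-upper b x∈S) S≤u) , (λ x∈T → ≤ᵢ-trans (⋁-upper b x∈T) T≤u) ]′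
        (x∈p∪q⁻ S T x∈)

  ⋁-isJoin : ∀ {b S} → (∀ u → (∀ x → x ∈ S → x ≤ᵢ u) → b ≤ᵢ u) → IsJoin S (⋁[ b ] S)
  ⋁-isJoin {b} {S} below = (λ x x∈S → ⋁-upper b x∈S) , λ u ub → ⋁-least b S (below u ub) ub

module MinimalSubsets {n : ℕ} (I : ImplicationAlgebra n) where
  open ImplicationAlgebra I

  ⊆M-∪ : ∀ {S T} → SubsetOfM S → SubsetOfM T → SubsetOfM (S ∪ T)
  ⊆M-∪ {S} {T} S⊆M T⊆M x x∈ = [ S⊆M x , T⊆M x ]′ (x∈p∪q⁻ S T x∈)

  ⊆M-⊆ : ∀ {S T} → S ⊆ T → SubsetOfM T → SubsetOfM S
  ⊆M-⊆ S⊆T T⊆M x x∈S = T⊆M x (S⊆T x∈S)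

  ⊆M∖⇒⊆M : ∀ {A X} → SubsetOfM∖ A X → SubsetOfM X
  ⊆M∖⇒⊆M X⊆M∖A x x∈X = proj₁ (X⊆M∖A x x∈X)

module BooleanInterval {n : ℕ} (I : ImplicationAlgebra n) where
  open ImplicationAlgebra I
  open Joins I

  module _ {j : Fin n} {K : ℕ} (Θ : IntervalIso j K) where
    open IntervalIso Θ

    to-mono : ∀ {x y} (j≤x : j ≤ᵢ x) (j≤y : j ≤ᵢ y) → x ≤ᵢ y → to x j≤x ⊆ to y j≤y
    to-mono j≤x j≤y = Equivalence.to (order _ _ j≤x j≤y)

    to-reflect : ∀ {x y} (j≤x : j ≤ᵢ x) (j≤y : j ≤ᵢ y) → to x j≤x ⊆ to y j≤y → x ≤ᵢ y
    to-reflect j≤x j≤y = Equivalence.from (order _ _ j≤x j≤y)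

    from-mono : ∀ {d d'} → d ⊆ d' → from d ≤ᵢ from d'
    from-mono {d} {d'} d⊆d' =
      to-reflect (from-in d) (from-in d') (subst₂ _⊆_ (sym (to∘from d)) (sym (to∘from d')) d⊆d')

    from-reflect : ∀ {d d'} → from d ≤ᵢ from d' → d ⊆ d'
    from-reflect {d} {d'} le = subst₂ _⊆_ (to∘from d) (to∘from d') (to-mono (from-in d) (from-in d') le)

    to-⊔ : ∀ {a c e} (j≤a : j ≤ᵢ a) (j≤c : j ≤ᵢ c) (j≤e : j ≤ᵢ e) → IsLub a c e →
           to e j≤e ≡ to a j≤a ∪ to c j≤c
    to-⊔ {a} {c} {e} j≤a j≤c j≤e (a≤e , c≤e , least) = ⊆-antisym e⊆∪ ∪⊆e
      where
      ∪-image = to a j≤a ∪ to c j≤c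
      below-w : ∀ {x} (j≤x : j ≤ᵢ x) → to x j≤x ⊆ ∪-image → x ≤ᵢ from ∪-image
      below-w j≤x ⊆∪ = to-reflect j≤x (from-in _) (subst (λ Q → to _ j≤x ⊆ Q) (sym (to∘from _)) ⊆∪)
      e⊆∪ : to e j≤e ⊆ ∪-image
      e⊆∪ = subst (λ Q → to e j≤e ⊆ Q) (to∘from _)
        (to-mono j≤e (from-in _) (least _ (below-w j≤a (p⊆p∪q _)) (below-w j≤c (q⊆p∪q _ _))))
      ∪⊆e : ∪-image ⊆ to e j≤e
      ∪⊆e = ∪-least (to-mono j≤a j≤e a≤e) (to-mono j≤c j≤e c≤e)

  -- Both inequalities come from the gap lemma,
  -- applied to 2^k ↪ 2^K and to the upper set of that image ↪ 2^k.
  interval-dim : ∀ {j x K k} (Ψ : IntervalIso j K) (j≤x : j ≤ᵢ x) (Φ : IntervalIso x k) →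
                 k + ∣ IntervalIso.to Ψ x j≤x ∣ ≡ K
  interval-dim {j} {x} {K} {k} Ψ j≤x Φ = ≤-antisym upper lower
    where
    module Ψ = IntervalIso Ψ
    module Φ = IntervalIso Φ
    s = Ψ.to x j≤x

    embed : Subset k → Subset K
    embed d = Ψ.to (Φ.from d) (≤ᵢ-trans j≤x (Φ.from-in d))

    -- 2^k embeds into 2^K above s, so 2^K has room for k points outside s
    embed-gap : ∣ embed ⊥ ∣ + k ≤ ∣ embed ⊤ ∣
    embed-gap = OrderEmbedding.gap ⊥ embed
      (λ d⊆d' → to-mono Ψ _ _ (from-mono Φ d⊆d'))
      (λ _ H⊆ → from-reflect Φ (to-reflect Ψ _ _ H⊆))
      k ⊥⊆ (≤-reflexive (trans (cong (k +_) (∣⊥∣≡0 k)) (+-identityʳ k)))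

    upper : k + ∣ s ∣ ≤ K
    upper = begin
      k + ∣ s ∣         ≡⟨ +-comm k _ ⟩
      ∣ s ∣ + k         ≤⟨ +-monoˡ-≤ k (p⊆q⇒∣p∣≤∣q∣ (to-mono Ψ j≤x _ (Φ.from-in ⊥))) ⟩
      ∣ embed ⊥ ∣ + k   ≤⟨ embed-gap ⟩
      ∣ embed ⊤ ∣       ≤⟨ ∣p∣≤n (embed ⊤) ⟩
      K                 ∎
      where open ≤-Reasoning

    above-x : ∀ d → s ⊆ d → x ≤ᵢ Ψ.from d
    above-x d s⊆d = to-reflect Ψ j≤x (Ψ.from-in d) (subst (s ⊆_) (sym (Ψ.to∘from d)) s⊆d)

    project : Subset K → Subset k
    project d = Φ.to (Ψ.from (s ∪ d)) (above-x (s ∪ d) (p⊆p∪q d))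

    project-reflect : ∀ {d d'} → s ⊆ d' → project d ⊆ project d' → d ⊆ d'
    project-reflect s⊆d' P⊆ =
      ⊆-trans (q⊆p∪q s _) (⊆-trans (from-reflect Ψ (to-reflect Φ _ _ P⊆)) (∪-least s⊆d' ⊆-refl))

    -- the upper set of s in 2^K embeds into 2^k, so k ≥ K - |s|
    codim : K ∸ ∣ s ∣ ≤ k
    codim = m+n≤o⇒n≤o ∣ project s ∣ (≤-trans
      (OrderEmbedding.gap s project
        (λ d⊆d' → to-mono Φ _ _ (from-mono Ψ (∪-monoʳ s d⊆d')))
        project-reflect
        (K ∸ ∣ s ∣) ⊆-refl (≤-reflexive (m∸n+n≡m (∣p∣≤n s))))
      (∣p∣≤n (project ⊤)))

    lower : K ≤ k + ∣ s ∣
    lower = begin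
      K                   ≤⟨ m≤n+m∸n K ∣ s ∣ ⟩
      ∣ s ∣ + (K ∸ ∣ s ∣) ≤⟨ +-monoʳ-≤ ∣ s ∣ codim ⟩
      ∣ s ∣ + k           ≡⟨ +-comm ∣ s ∣ k ⟩
      k + ∣ s ∣           ∎
      where open ≤-Reasoning

module Coordinates {n : ℕ} (I : ImplicationAlgebra n) (p : Subset n → ℕ)
  (profile : ImplicationAlgebra.IsProfile I p)
  (B : Subset n) (B⊆M : ImplicationAlgebra.SubsetOfM I B) (a : Fin n) (a∈B : a ∈ B) where
  open ImplicationAlgebra I
  open Joins I
  open BooleanInterval I
  open MinimalSubsets I

  b : Fin n
  b = ⋁[ a ] B

  b-isJoin : IsJoin B b
  b-isJoin = ⋁-isJoin (λ u ub → ub a a∈B)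

  base : IntervalIso b (p B)
  base = profile B B⊆M (a , a∈B) b b-isJoin

  coord : Subset n → Subset (p B)
  coord S = IntervalIso.to base (⋁[ b ] S) (⋁-base b S)

  coord-mono : ∀ {S T} → S ⊆ T → coord S ⊆ coord T
  coord-mono {S} {T} S⊆T = to-mono base (⋁-base b S) (⋁-base b T) (⋁-mono b S⊆T)

  coord-∪ : ∀ S T → coord (S ∪ T) ≡ coord S ∪ coord T
  coord-∪ S T = to-⊔ base (⋁-base b S) (⋁-base b T) (⋁-base b (S ∪ T)) (⋁-∪ b S T)

  -- for S ⊇ B, ⋁[ b ] S is the join of S, so p S is the codimension of c(S)
  profile-coord : ∀ S → SubsetOfM S → B ⊆ S → p S + ∣ coord S ∣ ≡ p B
  profile-coord S S⊆M B⊆S =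
    interval-dim base (⋁-base b S) (profile S S⊆M (a , B⊆S a∈B) (⋁[ b ] S) S-isJoin)
    where
    S-isJoin : IsJoin S (⋁[ b ] S)
    S-isJoin = ⋁-isJoin (λ u ub → proj₂ b-isJoin u (λ x x∈B → ub x (B⊆S x∈B)))

  -- |c| is submodular, since c turns unions into unions and is monotone
  coord-submodular : ∀ S T → ∣ coord (S ∪ T) ∣ + ∣ coord (S ∩ T) ∣ ≤ ∣ coord S ∣ + ∣ coord T ∣
  coord-submodular S T = begin
    ∣ coord (S ∪ T) ∣ + ∣ coord (S ∩ T) ∣          ≡⟨ cong (λ Q → ∣ Q ∣ + ∣ coord (S ∩ T) ∣) (coord-∪ S T) ⟩
    ∣ coord S ∪ coord T ∣ + ∣ coord (S ∩ T) ∣      ≤⟨ +-monoʳ-≤ ∣ coord S ∪ coord T ∣ (p⊆q⇒∣p∣≤∣q∣ ∩⊆) ⟩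
    ∣ coord S ∪ coord T ∣ + ∣ coord S ∩ coord T ∣  ≡⟨ card-modular (coord S) (coord T) ⟩
    ∣ coord S ∣ + ∣ coord T ∣                      ∎
    where
    open ≤-Reasoning
    ∩⊆ : coord (S ∩ T) ⊆ coord S ∩ coord T
    ∩⊆ x∈ = x∈p∩q⁺ (coord-mono (p∩q⊆p S T) x∈ , coord-mono (p∩q⊆q S T) x∈)

  q-coord : ∀ X A → SubsetOfM X → SubsetOfM A → B ⊆ X →
            p X ∸ p (X ∪ A) ≡ ∣ coord A ∩ ∁ (coord X) ∣
  q-coord X A X⊆M A⊆M B⊆X =
    complement-difference (p X) (p (X ∪ A)) (profile-coord X X⊆M B⊆X) (begin
      p (X ∪ A) + (∣ coord X ∣ + ∣ coord A ∩ ∁ (coord X) ∣) ≡⟨ cong (p (X ∪ A) +_) (card-∪-split (coord X) (coord A)) ⟨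
      p (X ∪ A) + ∣ coord X ∪ coord A ∣                  ≡⟨ cong (λ Q → p (X ∪ A) + ∣ Q ∣) (coord-∪ X A) ⟨
      p (X ∪ A) + ∣ coord (X ∪ A) ∣                      ≡⟨ profile-coord (X ∪ A) (⊆M-∪ X⊆M A⊆M) (⊆-trans B⊆X (p⊆p∪q A)) ⟩
      p B                                                ∎)
    where open ≡-Reasoning

module Profile {n : ℕ} (I : ImplicationAlgebra n) (p : Subset n → ℕ)
  (profile : ImplicationAlgebra.IsProfile I p) where
  open ImplicationAlgebra I
  open MinimalSubsets I

  decreasing : Decreasing SubsetOfM p
  decreasing S₁ S₂ S₁⊆M S₂⊆M (a , a∈S₁) S₁⊆S₂ =
    antitone-complement (p S₁) (p S₂) (profile-coord S₁ S₁⊆M ⊆-refl) (profile-coord S₂ S₂⊆M S₁⊆S₂)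
      (p⊆q⇒∣p∣≤∣q∣ (coord-mono S₁⊆S₂))
    where open Coordinates I p profile S₁ S₁⊆M a a∈S₁

  submodular : Submodular SubsetOfM p
  submodular S₁ S₂ S₁⊆M S₂⊆M (a , a∈S₁∩S₂) =
    submodular-complement (p S₁) (p S₂) (p (S₁ ∪ S₂)) (p (S₁ ∩ S₂))
      (profile-coord S₁ S₁⊆M (p∩q⊆p S₁ S₂)) (profile-coord S₂ S₂⊆M (p∩q⊆q S₁ S₂))
      (profile-coord (S₁ ∪ S₂) (⊆M-∪ S₁⊆M S₂⊆M) (⊆-trans (p∩q⊆p S₁ S₂) (p⊆p∪q S₂)))
      (profile-coord (S₁ ∩ S₂) S₁∩S₂⊆M ⊆-refl)
      (coord-submodular S₁ S₂)
    where
    S₁∩S₂⊆M = ⊆M-⊆ (p∩q⊆p S₁ S₂) S₁⊆M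
    open Coordinates I p profile (S₁ ∩ S₂) S₁∩S₂⊆M a a∈S₁∩S₂

  shifted-decreasing : ∀ {A} → SubsetOfM A → Decreasing (SubsetOfM∖ A) (λ X → p (X ∪ A))
  shifted-decreasing {A} A⊆M X₁ X₂ X₁⊆M∖A X₂⊆M∖A (x , x∈X₁) X₁⊆X₂ =
    decreasing (X₁ ∪ A) (X₂ ∪ A) (⊆M-∪ (⊆M∖⇒⊆M X₁⊆M∖A) A⊆M) (⊆M-∪ (⊆M∖⇒⊆M X₂⊆M∖A) A⊆M)
      (x , p⊆p∪q A x∈X₁) (∪-monoˡ A X₁⊆X₂)

  -- (X₁ ∪ A) ∪ (X₂ ∪ A) = (X₁ ∪ X₂) ∪ A and (X₁ ∪ A) ∩ (X₂ ∪ A) = (X₁ ∩ X₂) ∪ A,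
  -- so submodularity of p on the sets X ∪ A is submodularity of p_A
  shifted-submodular : ∀ {A} → SubsetOfM A → Submodular (SubsetOfM∖ A) (λ X → p (X ∪ A))
  shifted-submodular {A} A⊆M X₁ X₂ X₁⊆M∖A X₂⊆M∖A (x , x∈X₁∩X₂) =
    subst₂ (λ U V → p (X₁ ∪ A) + p (X₂ ∪ A) ≤ p U + p V)
      (sym (ICM.∙-distrʳ-∙ (∪-idempotentCommutativeMonoid n) A X₁ X₂)) (sym (∪-distribʳ-∩ A X₁ X₂))
      (submodular (X₁ ∪ A) (X₂ ∪ A) (⊆M-∪ (⊆M∖⇒⊆M X₁⊆M∖A) A⊆M) (⊆M-∪ (⊆M∖⇒⊆M X₂⊆M∖A) A⊆M)
        (x , x∈p∩q⁺ (p⊆p∪q A (proj₁ x∈X₁,X₂) , p⊆p∪q A (proj₂ x∈X₁,X₂))))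
    where
    x∈X₁,X₂ = x∈p∩q⁻ X₁ X₂ x∈X₁∩X₂

  relative-decreasing : ∀ {A} → SubsetOfM A → Decreasing (SubsetOfM∖ A) (λ X → p X ∸ p (X ∪ A))
  relative-decreasing {A} A⊆M X₁ X₂ X₁⊆M∖A X₂⊆M∖A (x , x∈X₁) X₁⊆X₂ = begin
    p X₂ ∸ p (X₂ ∪ A)          ≡⟨ q-coord X₂ A (⊆M∖⇒⊆M X₂⊆M∖A) A⊆M X₁⊆X₂ ⟩
    ∣ coord A ∩ ∁ (coord X₂) ∣   ≤⟨ p⊆q⇒∣p∣≤∣q∣ (outside-antitone (coord A) (coord-mono X₁⊆X₂)) ⟩
    ∣ coord A ∩ ∁ (coord X₁) ∣   ≡⟨ q-coord X₁ A (⊆M∖⇒⊆M X₁⊆M∖A) A⊆M ⊆-refl ⟨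
    p X₁ ∸ p (X₁ ∪ A)          ∎
    where
    open ≤-Reasoning
    open Coordinates I p profile X₁ (⊆M∖⇒⊆M X₁⊆M∖A) x x∈X₁

  relative-submodular : ∀ {A} → SubsetOfM A → Submodular (SubsetOfM∖ A) (λ X → p X ∸ p (X ∪ A))
  relative-submodular {A} A⊆M X₁ X₂ X₁⊆M∖A X₂⊆M∖A (x , x∈X₁∩X₂) = begin
    (p X₁ ∸ p (X₁ ∪ A)) + (p X₂ ∸ p (X₂ ∪ A))
      ≡⟨ cong₂ _+_ (q-coord X₁ A X₁⊆M A⊆M (p∩q⊆p X₁ X₂)) (q-coord X₂ A X₂⊆M A⊆M (p∩q⊆q X₁ X₂)) ⟩
    ∣ coord A ∩ ∁ (coord X₁) ∣ + ∣ coord A ∩ ∁ (coord X₂) ∣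
      ≤⟨ outside-submodular (coord A) (coord-mono (p∩q⊆p X₁ X₂)) (coord-mono (p∩q⊆q X₁ X₂)) ⟩
    ∣ coord A ∩ ∁ (coord X₁ ∪ coord X₂) ∣ + ∣ coord A ∩ ∁ (coord (X₁ ∩ X₂)) ∣
      ≡⟨ cong₂ _+_ q-∪ (q-coord (X₁ ∩ X₂) A X₁∩X₂⊆M A⊆M ⊆-refl) ⟨
    (p (X₁ ∪ X₂) ∸ p ((X₁ ∪ X₂) ∪ A)) + (p (X₁ ∩ X₂) ∸ p ((X₁ ∩ X₂) ∪ A)) ∎
    where
    open ≤-Reasoning
    X₁⊆M = ⊆M∖⇒⊆M X₁⊆M∖A
    X₂⊆M = ⊆M∖⇒⊆M X₂⊆M∖A
    X₁∩X₂⊆M = ⊆M-⊆ (p∩q⊆p X₁ X₂) X₁⊆M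
    open Coordinates I p profile (X₁ ∩ X₂) X₁∩X₂⊆M x x∈X₁∩X₂
    q-∪ : p (X₁ ∪ X₂) ∸ p ((X₁ ∪ X₂) ∪ A) ≡ ∣ coord A ∩ ∁ (coord X₁ ∪ coord X₂) ∣
    q-∪ = trans (q-coord (X₁ ∪ X₂) A (⊆M-∪ X₁⊆M X₂⊆M) A⊆M (⊆-trans (p∩q⊆p X₁ X₂) (p⊆p∪q X₂)))
                (cong (λ Q → ∣ coord A ∩ ∁ Q ∣) (coord-∪ X₁ X₂))

theorem4p3 : (n : ℕ) (I : ImplicationAlgebra n) (p : Subset n → ℕ) →
    ImplicationAlgebra.IsProfile I p →
    Decreasing (ImplicationAlgebra.SubsetOfM I) p
    × Submodular (ImplicationAlgebra.SubsetOfM I) p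
    × (∀ A → ImplicationAlgebra.SubsetOfM I A → Nonempty A →
        Decreasing (ImplicationAlgebra.SubsetOfM∖ I A) (λ X → p (X ∪ A))
        × Submodular (ImplicationAlgebra.SubsetOfM∖ I A) (λ X → p (X ∪ A))
        × Decreasing (ImplicationAlgebra.SubsetOfM∖ I A) (λ X → p X ∸ p (X ∪ A))
        × Submodular (ImplicationAlgebra.SubsetOfM∖ I A) (λ X → p X ∸ p (X ∪ A)))
theorem4p3 n I p profile =
  decreasing , submodular ,
  λ A A⊆M _ → shifted-decreasing A⊆M , shifted-submodular A⊆M ,
              relative-decreasing A⊆M , relative-submodular A⊆M
  where open Profile I p profile
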